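{- Let $\alpha,\beta \in S_n$ and let $k$ be a nonnegative integer. Then $H(\alpha\beta,\beta\alpha)=k$ if and only if there exist $h$ cycles $\beta_1,\dots,\beta_h$ of $\beta$ such that $\alpha\beta(b)=\beta\alpha(b)$ for every point $b$ of every cycle of $\beta$ not in $\{\beta_1,\dots,\beta_h\}$, and for every $i\in\{1,\dots,h\}$, $\alpha\beta_i\alpha^{ -1}=(P^{(i)}_1\dots P^{(i)}_{k_i})$ with $k_i\ge 1$, $k=k_1+\dots+k_h$, where: (1) if $k_i=1$, then $P^{(i)}_1$ is a proper block in a cycle of $\beta$; (2) if $k_i>1$, then $P^{(i)}_1,\dots,P^{(i)}_{k_i}$ are $k_i$ pairwise disjoint blocks, from one or more cycles of $\beta$, such that for every $r\in[k_i]$ the string $P^{(i)}_rP^{(i)}_{r+1\bmod k_i}$ is not a block in any cycle of $\beta$; (3) $\{P^{(1)}_1,\dots,P^{(1)}_{k_1},\dots,P^{(h)}_1,\dots,P^{(h)}_{k_h}\}$ is a set of pairwise disjoint blocks from one or more cycles of $\beta$.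
   Context: $S_n$ is the symmetric group on $[n]$; products are composed right to left. $H(\sigma,\tau)=|\{a\in[n]:\sigma(a)\ne\tau(a)\}|$ is the Hamming metric. Cycles of a permutation include fixed points as $1$-cycles. Convention: $m \bmod m = m$. For a cycle $(a_1\dots a_m)$, a block is a string $a_ia_{i+1}\dots a_{i+l-1}$ of $l$ consecutive entries, $1\le l\le m$, indices mod $m$; it is proper if $l<m$, improper if $l=m$. Disjoint blocks share no points; products of blocks are concatenations. For a cycle $\sigma$ and string $Q$, $\sigma=(Q)$ means $Q$ is one of the cyclic rotations of the cycle notation of $\sigma$. -}

module Defs where

open import Data.Nat using (ℕ; zero; suc; _<_; _%_; _≥_; _>_)
open import Data.Nat.DivMod using (m%n<n)
open import Data.Empty using (⊥)
open import Data.Nat.ListAction using (sum)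
open import Data.Fin using (Fin; toℕ; fromℕ<; _≟_)
open import Data.Fin.Permutation using (Permutation′; _∘ₚ_; _⟨$⟩ʳ_)
open import Data.List using (List; []; _∷_; _++_; drop; take; length; filter; map; concat; tabulate; allFin)
open import Data.List.Relation.Unary.Unique.Propositional using (Unique)
open import Data.List.Relation.Unary.Linked using (Linked)
open import Data.List.Relation.Binary.Disjoint.Propositional using (Disjoint)
open import Data.List.Membership.Propositional using (_∈_; _∉_)
open import Data.Product using (Σ; ∃; _×_; _,_)
open import Relation.Nullary using (¬_; ¬?)
open import Relation.Binary.PropositionalEquality using (_≡_; _≢_)

-- Product in S_n, composed right to left: (α · β)(x) = α (β x).
_·_ : ∀ {n} → Permutation′ n → Permutation′ n → Permutation′ n
α · β = β ∘ₚ α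

H : ∀ {n} → Permutation′ n → Permutation′ n → ℕ
H {n} σ τ = length (filter (λ a → ¬? ((σ ⟨$⟩ʳ a) ≟ (τ ⟨$⟩ʳ a))) (allFin n))

rotate : ∀ {A : Set} → ℕ → List A → List A
rotate j xs = drop j xs ++ take j xs

IsRotationOf : ∀ {A : Set} → List A → List A → Set
IsRotationOf Q C = ∃ λ j → rotate j C ≡ Q

last′ : ∀ {A : Set} → A → List A → A
last′ x [] = x
last′ x (y ∷ ys) = last′ y ys

-- C is the cycle notation (some rotation) of a cycle of β (fixed points are 1-cycles):
-- C = (a₁ … aₘ) with distinct entries, β aⱼ = aⱼ₊₁ and β aₘ = a₁.
IsCycleOf : ∀ {n} → Permutation′ n → List (Fin n) → Set
IsCycleOf β [] = ⊥
IsCycleOf β (x ∷ xs) =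
  Unique (x ∷ xs) × Linked (λ a b → β ⟨$⟩ʳ a ≡ b) (x ∷ xs) × (β ⟨$⟩ʳ last′ x xs ≡ x)

-- P is a block of the cycle with notation C: a string of l consecutive entries, 1 ≤ l ≤ m.
IsBlock : ∀ {A : Set} → List A → List A → Set
IsBlock C P = (P ≢ []) × ∃ λ j → ∃ λ R → P ++ R ≡ rotate j C

IsProperBlock : ∀ {A : Set} → List A → List A → Set
IsProperBlock C P = (P ≢ []) × ∃ λ j → ∃ λ R → (R ≢ []) × (P ++ R ≡ rotate j C)

BlockOf : ∀ {n} → Permutation′ n → List (Fin n) → Set
BlockOf β P = ∃ λ C → IsCycleOf β C × IsBlock C P

ProperBlockOf : ∀ {n} → Permutation′ n → List (Fin n) → Set
ProperBlockOf β P = ∃ λ C → IsCycleOf β C × IsProperBlock C P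

-- r ↦ r + 1 mod k on indices (0-based Fin k, i.e. the convention m mod m = m in 1-based indexing).
cycSuc : ∀ {k} → Fin k → Fin k
cycSuc {suc k} r = fromℕ< (m%n<n (suc (toℕ r)) (suc k))

Σ[_] : ∀ {h} → (Fin h → ℕ) → ℕ
Σ[ f ] = sum (tabulate f)

concatF : ∀ {A : Set} {k} → (Fin k → List A) → List A
concatF P = concat (tabulate P)

module Submission where

-- Put γ = αβα⁻¹.  Since (αβ)(x) = γ(α x) and (βα)(x) = β(α x), the points
-- where αβ and βα differ correspond, via α, to the "breaks" of γ: points y with γ y ≠ β y.
-- The cycle of γ through α x is α applied to the cycle of β through x, and it decomposes
-- uniquely into maximal β-runs (strings y, β y, β² y, … of consecutive entries of a cycle
-- of β); the number of breaks on it is exactly the number of runs, provided it has a break.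
-- Runs with distinct entries are precisely the blocks of β, a run is a proper block
-- exactly when β does not lead from its end back to its start, and two consecutive runs
-- are "unlinked" exactly when their concatenation is not a block.  Conditions (1)–(2)
-- therefore say that P⁽ⁱ⁾₁ … P⁽ⁱ⁾_{kᵢ} is the run decomposition of αβᵢα⁻¹.

open import Defs
open import Data.Nat using (ℕ; zero; suc; _+_; _∸_; _<_; _≤_; _≥_; _>_; z≤n; s≤s; _≤?_)
open import Data.Nat.Properties
  using (+-suc; +-identityʳ; n<1+n; m+[n∸m]≡n; m≤n⇒m<n∨m≡n; ≰⇒>; ≤-pred; <⇒≤; ≤-antisym; m<n⇒m<1+n; 1+n≢n; m<n⇒0<n∸m)
open import Data.Nat.ListAction using (sum)
open import Data.Fin using (Fin; zero; suc; toℕ; fromℕ; inject₁; _≟_)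
import Data.Fin.Relation.Unary.Top as Top
open Top using (‵fromℕ; ‵inject₁)
open import Data.Fin.Properties
  using (toℕ<n; toℕ-injective; toℕ-fromℕ<; toℕ-inject₁; toℕ-fromℕ; suc-injective; pigeonhole; any?)
open import Data.Nat.DivMod using (m<n⇒m%n≡m; n%n≡0; _%_)
open import Data.Fin.Permutation using (Permutation′; _⟨$⟩ʳ_; _⟨$⟩ˡ_; inverseˡ)
open import Data.List using (List; []; _∷_; _++_; drop; take; length; filter; map; concat; tabulate; lookup; allFin)
open import Data.List.Properties
  using (++-identityʳ; take++drop≡id; filter-++; length-++; tabulate-cong; tabulate-lookup; length-tabulate; filter-accept; filter-reject)
open import Data.List.Relation.Unary.All using (All; []; _∷_)
import Data.List.Relation.Unary.All as All
import Data.List.Relation.Unary.All.Properties as AllP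
open import Data.List.Relation.Unary.AllPairs using ([]; _∷_)
open import Data.List.Relation.Unary.Any using (here; there)
open import Data.List.Relation.Unary.Linked using (Linked; [-]; _∷_)
open import Data.List.Relation.Unary.Unique.Propositional using (Unique)
import Data.List.Relation.Unary.Unique.Propositional.Properties as Unique
open import Data.List.Relation.Binary.Disjoint.Propositional using (Disjoint)
open import Data.List.Relation.Binary.Permutation.Propositional using (_↭_; ↭-trans; ↭-reflexive)
open import Data.List.Relation.Binary.Permutation.Propositional.Properties using (++-comm; filter-↭; ↭-length)
open import Data.List.Membership.Propositional using (_∈_; _∉_)
open import Data.List.Membership.Propositional.Properties
  using (∈-++⁺ˡ; ∈-++⁺ʳ; ∈-++⁻; ∈-∃++; ∈-map⁻; ∈-allFin; ∈-lookup)
open import Data.List.Membership.DecPropositional using () renaming (_∈?_ to member?)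
open import Data.Product using (Σ; ∃; _×_; _,_; proj₁; proj₂)
open import Data.Sum using (_⊎_; inj₁; inj₂; [_,_]′)
open import Data.Empty using (⊥; ⊥-elim)
open import Data.Unit using (⊤; tt)
open import Function.Bundles using (_⇔_; mk⇔)
open import Relation.Nullary using (¬_; Dec; yes; no; ¬?)
open import Relation.Nullary.Decidable using (_×-dec_; decidable-stable)
open import Relation.Unary using (Decidable)
open import Relation.Binary.PropositionalEquality
  using (_≡_; _≢_; refl; sym; trans; cong; cong₂; subst; module ≡-Reasoning)

module _ {X : Set} where

  Chain : (X → X → Set) → X → List X → X → Set
  Chain R x [] e = R x e
  Chain R x (y ∷ ys) e = R x y × Chain R y ys e

  chain-++⁻ : ∀ {R} x xs {y} ys {e} → Chain R x (xs ++ y ∷ ys) e → Chain R x xs y × Chain R y ys e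
  chain-++⁻ x [] ys (r , c) = r , c
  chain-++⁻ x (z ∷ xs) ys (r , c) with chain-++⁻ z xs ys c
  ... | c₁ , c₂ = (r , c₁) , c₂

  chain-++⁺ : ∀ {R} x xs {y} ys {e} → Chain R x xs y → Chain R y ys e → Chain R x (xs ++ y ∷ ys) e
  chain-++⁺ x [] ys r c = r , c
  chain-++⁺ x (z ∷ xs) ys (r , c₁) c₂ = r , chain-++⁺ z xs ys c₁ c₂

  chain-last : ∀ {R} x xs {e} → Chain R x xs e → R (last′ x xs) e
  chain-last x [] c = c
  chain-last x (y ∷ ys) (_ , c) = chain-last y ys c

  last′∈ : ∀ (y : X) ys → last′ y ys ∈ y ∷ ys
  last′∈ y [] = here refl
  last′∈ y (z ∷ zs) = there (last′∈ z zs)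

  Cyclic : (X → X → Set) → List X → Set
  Cyclic R [] = ⊥
  Cyclic R (x ∷ xs) = Chain R x xs x

  cyclic-swap : ∀ {R} A B → Cyclic R (A ++ B) → Cyclic R (B ++ A)
  cyclic-swap [] B c = subst (Cyclic _) (sym (++-identityʳ B)) c
  cyclic-swap (x ∷ xs) [] c = subst (Cyclic _) (++-identityʳ (x ∷ xs)) c
  cyclic-swap (x ∷ xs) (y ∷ ys) c with chain-++⁻ x xs ys c
  ... | c₁ , c₂ = chain-++⁺ y ys xs c₂ c₁

  cyclic-rotate : ∀ {R} j L → Cyclic R L → Cyclic R (rotate j L)
  cyclic-rotate j L c = cyclic-swap (take j L) (drop j L) (subst (Cyclic _) (sym (take++drop≡id j L)) c)

  rotate-↭ : ∀ j (L : List X) → rotate j L ↭ L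
  rotate-↭ j L = ↭-trans (++-comm (drop j L) (take j L)) (↭-reflexive (take++drop≡id j L))

  unique-++⁻ : ∀ (A : List X) {B} → Unique (A ++ B) → Unique A × Unique B × Disjoint A B
  unique-++⁻ [] u = [] , u , λ ()
  unique-++⁻ (x ∷ A) (x∉ ∷ u) with unique-++⁻ A u
  ... | uA , uB , d = (All.tabulate (λ m → All.lookup x∉ (∈-++⁺ˡ m)) ∷ uA) , uB , disjoint
    where
    disjoint : Disjoint (x ∷ A) _
    disjoint (here refl , m₂) = All.lookup x∉ (∈-++⁺ʳ A m₂) refl
    disjoint (there m₁ , m₂) = d (m₁ , m₂)

  unique-rotate : ∀ j (L : List X) → Unique L → Unique (rotate j L)
  unique-rotate j L u with unique-++⁻ (take j L) (subst Unique (sym (take++drop≡id j L)) u)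
  ... | uT , uD , d = Unique.++⁺ uD uT (λ (m₁ , m₂) → d (m₂ , m₁))

  ∈-concatF⁺ : ∀ {k} (P : Fin k → List X) r {x} → x ∈ P r → x ∈ concatF P
  ∈-concatF⁺ P zero m = ∈-++⁺ˡ m
  ∈-concatF⁺ P (suc r) m = ∈-++⁺ʳ (P zero) (∈-concatF⁺ (λ i → P (suc i)) r m)

  ∈-concatF⁻ : ∀ {k} (P : Fin k → List X) {x} → x ∈ concatF P → ∃ λ r → x ∈ P r
  ∈-concatF⁻ {suc k} P m with ∈-++⁻ (P zero) m
  ... | inj₁ m′ = zero , m′
  ... | inj₂ m′ with ∈-concatF⁻ (λ i → P (suc i)) m′
  ... | r , m″ = suc r , m″

  unique-concatF⁻ : ∀ {k} (P : Fin k → List X) → Unique (concatF P) →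
    (∀ r → Unique (P r)) × (∀ r s → r ≢ s → Disjoint (P r) (P s))
  unique-concatF⁻ {zero} P u = (λ ()) , λ ()
  unique-concatF⁻ {suc k} P u with unique-++⁻ (P zero) u
  ... | u₀ , uᵣ , d with unique-concatF⁻ (λ i → P (suc i)) uᵣ
  ... | us , ds = (λ { zero → u₀ ; (suc r) → us r }) , disjoint
    where
    disjoint : ∀ r s → r ≢ s → Disjoint (P r) (P s)
    disjoint zero zero ne = ⊥-elim (ne refl)
    disjoint zero (suc s) ne (m₁ , m₂) = d (m₁ , ∈-concatF⁺ (λ i → P (suc i)) s m₂)
    disjoint (suc r) zero ne (m₁ , m₂) = d (m₂ , ∈-concatF⁺ (λ i → P (suc i)) r m₁)
    disjoint (suc r) (suc s) ne = ds r s (λ e → ne (cong suc e))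

  unique-concatF⁺ : ∀ {k} (P : Fin k → List X) → (∀ r → Unique (P r)) →
    (∀ r s → r ≢ s → Disjoint (P r) (P s)) → Unique (concatF P)
  unique-concatF⁺ {zero} P u d = []
  unique-concatF⁺ {suc k} P u d = Unique.++⁺ (u zero)
    (unique-concatF⁺ (λ i → P (suc i)) (λ r → u (suc r))
      (λ r s ne → d (suc r) (suc s) (λ e → ne (suc-injective e))))
    (λ (m₁ , m₂) → let (r , m) = ∈-concatF⁻ (λ i → P (suc i)) m₂ in d zero (suc r) (λ ()) (m₁ , m))

  count : {P : X → Set} → Decidable P → List X → ℕ
  count P? xs = length (filter P? xs)

  count-++ : ∀ {P : X → Set} (P? : Decidable P) A B → count P? (A ++ B) ≡ count P? A + count P? B
  count-++ P? A B = trans (cong length (filter-++ P? A B)) (length-++ (filter P? A))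

  count-rotate : ∀ {P : X → Set} (P? : Decidable P) j L → count P? (rotate j L) ≡ count P? L
  count-rotate P? j L = ↭-length (filter-↭ P? (rotate-↭ j L))

  count-concatF : ∀ {P : X → Set} (P? : Decidable P) {h} (C : Fin h → List X) →
    count P? (concatF C) ≡ Σ[ (λ i → count P? (C i)) ]
  count-concatF P? {zero} C = refl
  count-concatF P? {suc h} C =
    trans (count-++ P? (C zero) _) (cong (count P? (C zero) +_) (count-concatF P? (λ i → C (suc i))))

  count-≤ : ∀ {P : X → Set} (P? : Decidable P) (L M : List X) → Unique L →
    (∀ x → P x → x ∈ L → x ∈ M) → count P? L ≤ count P? M
  count-≤ P? [] M u sub = z≤n
  count-≤ P? (x ∷ L) M (x∉ ∷ u) sub with P? x
  ... | no _ = count-≤ P? L M u (λ y p m → sub y p (there m))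
  ... | yes p with ∈-∃++ (sub x p (here refl))
  ... | M₁ , M₂ , refl = subst (suc (count P? L) ≤_) (sym removeX) (s≤s (count-≤ P? L (M₁ ++ M₂) u sub′))
    where
    removeX : count P? (M₁ ++ x ∷ M₂) ≡ suc (count P? (M₁ ++ M₂))
    removeX = begin
      count P? (M₁ ++ x ∷ M₂)          ≡⟨ count-++ P? M₁ (x ∷ M₂) ⟩
      count P? M₁ + count P? (x ∷ M₂)  ≡⟨ cong (λ l → count P? M₁ + length l) (filter-accept P? p) ⟩
      count P? M₁ + suc (count P? M₂)  ≡⟨ +-suc (count P? M₁) _ ⟩
      suc (count P? M₁ + count P? M₂)  ≡⟨ cong suc (count-++ P? M₁ M₂) ⟨
      suc (count P? (M₁ ++ M₂))        ∎
      where open ≡-Reasoning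
    sub′ : ∀ y → _ → y ∈ L → y ∈ M₁ ++ M₂
    sub′ y py m with ∈-++⁻ M₁ (sub y py (there m))
    ... | inj₁ m₁ = ∈-++⁺ˡ m₁
    ... | inj₂ (here refl) = ⊥-elim (All.lookup x∉ m refl)
    ... | inj₂ (there m₂) = ∈-++⁺ʳ M₁ m₂

count-map : ∀ {X Y : Set} {P : X → Set} {Q : Y → Set} (P? : Decidable P) (Q? : Decidable Q) (f : Y → X) →
  (∀ y → (Q y → P (f y)) × (P (f y) → Q y)) → ∀ ys → count P? (map f ys) ≡ count Q? ys
count-map P? Q? f corr [] = refl
count-map P? Q? f corr (y ∷ ys) with P? (f y) | Q? y
... | yes _ | yes _ = cong suc (count-map P? Q? f corr ys)
... | no _  | no _  = count-map P? Q? f corr ys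
... | yes p | no ¬q = ⊥-elim (¬q (proj₂ (corr y) p))
... | no ¬p | yes q = ⊥-elim (¬p (proj₁ (corr y) q))

cycSuc-inject₁ : ∀ {k} (r : Fin k) → cycSuc {suc k} (inject₁ r) ≡ suc r
cycSuc-inject₁ {k} r = toℕ-injective (begin
  toℕ (cycSuc (inject₁ r))     ≡⟨ toℕ-fromℕ< _ ⟩
  suc (toℕ (inject₁ r)) % suc k ≡⟨ cong (λ t → suc t % suc k) (toℕ-inject₁ r) ⟩
  suc (toℕ r) % suc k          ≡⟨ m<n⇒m%n≡m (s≤s (toℕ<n r)) ⟩
  suc (toℕ r)                  ∎)
  where open ≡-Reasoning

cycSuc-fromℕ : ∀ k → cycSuc {suc k} (fromℕ k) ≡ zero
cycSuc-fromℕ k = toℕ-injective (begin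
  toℕ (cycSuc (fromℕ k))    ≡⟨ toℕ-fromℕ< _ ⟩
  suc (toℕ (fromℕ k)) % suc k ≡⟨ cong (λ t → suc t % suc k) (toℕ-fromℕ k) ⟩
  suc k % suc k             ≡⟨ n%n≡0 (suc k) ⟩
  0                         ∎)
  where open ≡-Reasoning

cycSuc-≢ : ∀ {k} (r : Fin (suc (suc k))) → cycSuc r ≢ r
cycSuc-≢ r eq with Top.view r
... | ‵fromℕ with () ← trans (sym (cycSuc-fromℕ _)) eq
... | ‵inject₁ r′ = 1+n≢n (begin
  suc (toℕ r′)            ≡⟨ cong toℕ (sym (cycSuc-inject₁ r′)) ⟩
  toℕ (cycSuc (inject₁ r′)) ≡⟨ cong toℕ eq ⟩
  toℕ (inject₁ r′)         ≡⟨ toℕ-inject₁ r′ ⟩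
  toℕ r′                   ∎)
  where open ≡-Reasoning

cycSuc-Fin1 : (r : Fin 1) → cycSuc r ≡ r
cycSuc-Fin1 zero = refl

module _ {X : Set} {R : X → X → Set} where

  chain-tabulate⁻ : ∀ k (f : Fin (suc k) → X) e → Chain R (f zero) (tabulate (λ i → f (suc i))) e →
    (∀ (r : Fin k) → R (f (inject₁ r)) (f (suc r))) × R (f (fromℕ k)) e
  chain-tabulate⁻ zero f e c = (λ ()) , c
  chain-tabulate⁻ (suc k) f e (r₀ , c) with chain-tabulate⁻ k (λ i → f (suc i)) e c
  ... | steps , end = (λ { zero → r₀ ; (suc r) → steps r }) , end

  chain-tabulate⁺ : ∀ k (f : Fin (suc k) → X) e →
    (∀ (r : Fin k) → R (f (inject₁ r)) (f (suc r))) → R (f (fromℕ k)) e →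
    Chain R (f zero) (tabulate (λ i → f (suc i))) e
  chain-tabulate⁺ zero f e steps end = end
  chain-tabulate⁺ (suc k) f e steps end =
    steps zero , chain-tabulate⁺ k (λ i → f (suc i)) e (λ r → steps (suc r)) end

  cyclic-tabulate⁻ : ∀ k (f : Fin (suc k) → X) →
    Chain R (f zero) (tabulate (λ i → f (suc i))) (f zero) → ∀ r → R (f r) (f (cycSuc r))
  cyclic-tabulate⁻ k f c r with chain-tabulate⁻ k f (f zero) c | Top.view r
  ... | steps , end | ‵fromℕ = subst (λ z → R (f (fromℕ k)) (f z)) (sym (cycSuc-fromℕ k)) end
  ... | steps , end | ‵inject₁ r′ = subst (λ z → R (f (inject₁ r′)) (f z)) (sym (cycSuc-inject₁ r′)) (steps r′)

  cyclic-tabulate⁺ : ∀ k (f : Fin (suc k) → X) →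
    (∀ r → R (f r) (f (cycSuc r))) → Chain R (f zero) (tabulate (λ i → f (suc i))) (f zero)
  cyclic-tabulate⁺ k f next = chain-tabulate⁺ k f (f zero)
    (λ r → subst (λ z → R (f (inject₁ r)) (f z)) (cycSuc-inject₁ r) (next (inject₁ r)))
    (subst (λ z → R (f (fromℕ k)) (f z)) (cycSuc-fromℕ k) (next (fromℕ k)))

module _ {P : ℕ → Set} (P? : ∀ k → Dec (P k)) where

  least-below : ∀ N → (∃ λ m → P m × (∀ k → k < m → ¬ P k)) ⊎ (∀ k → k < N → ¬ P k)
  least-below zero = inj₂ (λ k ())
  least-below (suc N) with least-below N
  ... | inj₁ found = inj₁ found
  ... | inj₂ none with P? N
  ... | yes p = inj₁ (N , p , none)
  ... | no ¬p = inj₂ λ k k<1+N → [ none k , (λ { refl → ¬p }) ]′ (m≤n⇒m<n∨m≡n (≤-pred k<1+N))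

  least : ∀ N → P N → ∃ λ m → P m × (∀ k → k < m → ¬ P k)
  least N pN with least-below (suc N)
  ... | inj₁ found = found
  ... | inj₂ none = ⊥-elim (none N (n<1+n N) pN)

module Orbits {n : ℕ} (β : Permutation′ n) where

  next : Fin n → Fin n
  next x = β ⟨$⟩ʳ x

  Step : Fin n → Fin n → Set
  Step u v = next u ≡ v

  next-injective : ∀ {u v} → next u ≡ next v → u ≡ v
  next-injective {u} {v} e = trans (sym (inverseˡ β)) (trans (cong (β ⟨$⟩ˡ_) e) (inverseˡ β))

  isCycle⇒ : ∀ x xs → IsCycleOf β (x ∷ xs) → Unique (x ∷ xs) × Cyclic Step (x ∷ xs)
  isCycle⇒ x xs (u , linked , closing) = u , toChain x xs linked closing
    where
    toChain : ∀ x xs {e} → Linked Step (x ∷ xs) → Step (last′ x xs) e → Chain Step x xs e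
    toChain x [] _ q = q
    toChain x (y ∷ xs) (r ∷ l) q = r , toChain y xs l q

  isCycle⇐ : ∀ x xs → Unique (x ∷ xs) → Cyclic Step (x ∷ xs) → IsCycleOf β (x ∷ xs)
  isCycle⇐ x xs u c = u , fromChain x xs c
    where
    fromChain : ∀ x xs {e} → Chain Step x xs e → Linked Step (x ∷ xs) × Step (last′ x xs) e
    fromChain x [] c = [-] , c
    fromChain x (y ∷ xs) (r , c) with fromChain y xs c
    ... | l , q = (r ∷ l) , q

  cycle-unique : ∀ C → IsCycleOf β C → Unique C
  cycle-unique (x ∷ xs) (u , _) = u

  iterate : ℕ → Fin n → Fin n
  iterate zero y = y
  iterate (suc t) y = next (iterate t y)

  orbitList : Fin n → ℕ → List (Fin n)
  orbitList y zero = []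
  orbitList y (suc l) = y ∷ orbitList (next y) l

  iterate-next : ∀ t y → iterate t (next y) ≡ iterate (suc t) y
  iterate-next zero y = refl
  iterate-next (suc t) y = cong next (iterate-next t y)

  iterate-cancel : ∀ i d y → iterate (i + d) y ≡ iterate i y → iterate d y ≡ y
  iterate-cancel zero d y e = e
  iterate-cancel (suc i) d y e = iterate-cancel i d y (next-injective e)

  -- Every point returns to itself: by pigeonhole two of y, β y, …, βⁿ y coincide.
  period : ∀ y → ∃ λ p → 1 ≤ p × iterate p y ≡ y
  period y with pigeonhole (n<1+n n) (λ i → iterate (toℕ i) y)
  ... | i , j , i<j , e = toℕ j ∸ toℕ i , m<n⇒0<n∸m i<j ,
    iterate-cancel (toℕ i) _ y (trans (cong (λ t → iterate t y) (m+[n∸m]≡n (<⇒≤ i<j))) (sym e))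

  ∈-orbitList⁻ : ∀ l y {z} → z ∈ orbitList y l → ∃ λ i → i < l × z ≡ iterate i y
  ∈-orbitList⁻ (suc l) y (here e) = 0 , s≤s z≤n , e
  ∈-orbitList⁻ (suc l) y (there m) with ∈-orbitList⁻ l (next y) m
  ... | i , i<l , e = suc i , s≤s i<l , trans e (iterate-next i y)

  ∈-orbitList⁺ : ∀ l y i → i < l → iterate i y ∈ orbitList y l
  ∈-orbitList⁺ (suc l) y zero _ = here refl
  ∈-orbitList⁺ (suc l) y (suc i) (s≤s i<l) =
    there (subst (_∈ orbitList (next y) l) (iterate-next i y) (∈-orbitList⁺ l (next y) i i<l))

  orbitList-unique : ∀ l y → (∀ d → 1 ≤ d → d < l → iterate d y ≢ y) → Unique (orbitList y l)
  orbitList-unique zero y h = []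
  orbitList-unique (suc l) y h = All.tabulate (λ m e → y∉ m e) ∷ orbitList-unique l (next y) h′
    where
    y∉ : ∀ {z} → z ∈ orbitList (next y) l → y ≡ z → ⊥
    y∉ m refl with ∈-orbitList⁻ l (next y) m
    ... | i , i<l , e = h (suc i) (s≤s z≤n) (s≤s i<l) (sym (trans e (iterate-next i y)))
    h′ : ∀ d → 1 ≤ d → d < l → iterate d (next y) ≢ next y
    h′ d 1≤d d<l e = h d 1≤d (m<n⇒m<1+n d<l) (next-injective (trans (sym (iterate-next d y)) e))

  orbitList-chain : ∀ l y → Chain Step y (orbitList (next y) l) (iterate (suc l) y)
  orbitList-chain zero y = refl
  orbitList-chain (suc l) y =
    refl , subst (Chain Step (next y) (orbitList (next (next y)) l)) (iterate-next (suc l) y) (orbitList-chain l (next y))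

  orbitList-+ : ∀ l r y → orbitList y (l + r) ≡ orbitList y l ++ orbitList (iterate l y) r
  orbitList-+ zero r y = refl
  orbitList-+ (suc l) r y = cong (y ∷_)
    (trans (orbitList-+ l r (next y)) (cong (λ z → orbitList (next y) l ++ orbitList z r) (iterate-next l y)))

  last-orbitList : ∀ l y → last′ y (orbitList (next y) l) ≡ iterate l y
  last-orbitList zero y = refl
  last-orbitList (suc l) y = trans (last-orbitList l (next y)) (iterate-next l y)

  orbit : ∀ y → ∃ λ m → IsCycleOf β (orbitList y (suc m)) × iterate (suc m) y ≡ y
  orbit y with period y
  ... | p , p≥1 , ret with least (λ k → (1 ≤? k) ×-dec (iterate k y ≟ y)) p (p≥1 , ret)
  ... | zero , (() , _) , _
  ... | suc m , (_ , ret′) , minimal = m ,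
    isCycle⇐ y (orbitList (next y) m)
      (orbitList-unique (suc m) y (λ d 1≤d d<m eq → minimal d d<m (1≤d , eq)))
      (subst (Chain Step y (orbitList (next y) m)) ret′ (orbitList-chain m y)) ,
    ret′

  Path : Fin n → List (Fin n) → Set
  Path x [] = ⊤
  Path x (y ∷ ys) = next x ≡ y × Path y ys

  IsRun : List (Fin n) → Set
  IsRun [] = ⊥
  IsRun (x ∷ xs) = Path x xs

  Link : List (Fin n) → List (Fin n) → Set
  Link (x ∷ xs) (y ∷ ys) = next (last′ x xs) ≡ y
  Link _ _ = ⊥

  Unlinked : List (Fin n) → List (Fin n) → Set
  Unlinked Q Q′ = ¬ Link Q Q′

  chain⇒path : ∀ x xs ys {e} → Chain Step x (xs ++ ys) e → Path x xs
  chain⇒path x [] ys c = tt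
  chain⇒path x (y ∷ xs) ys (r , c) = r , chain⇒path y xs ys c

  path-++⁻ : ∀ x xs {y} ys → Path x (xs ++ y ∷ ys) → Path x xs × next (last′ x xs) ≡ y × Path y ys
  path-++⁻ x [] ys (r , p) = tt , r , p
  path-++⁻ x (z ∷ xs) ys (r , p) with path-++⁻ z xs ys p
  ... | p₁ , q , p₂ = (r , p₁) , q , p₂

  path-++⁺ : ∀ x xs {y} ys → Path x xs → next (last′ x xs) ≡ y → Path y ys → Path x (xs ++ y ∷ ys)
  path-++⁺ x [] ys p₁ q p₂ = q , p₂
  path-++⁺ x (z ∷ xs) ys (r , p₁) q p₂ = r , path-++⁺ z xs ys p₁ q p₂

  path⇒orbitList : ∀ x xs → Path x xs → xs ≡ orbitList (next x) (length xs)
  path⇒orbitList x [] p = refl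
  path⇒orbitList x (y ∷ ys) (refl , p) = cong (y ∷_) (path⇒orbitList y ys p)

  run-++ : ∀ Q Q′ → IsRun Q → IsRun Q′ → Link Q Q′ → IsRun (Q ++ Q′)
  run-++ (x ∷ xs) (y ∷ ys) p p′ l = path-++⁺ x xs ys p l p′

  block⇒run : ∀ P → BlockOf β P → IsRun P × Unique P
  block⇒run [] (_ , _ , P≢[] , _) = ⊥-elim (P≢[] refl)
  block⇒run (x ∷ xs) ([] , () , _)
  block⇒run (x ∷ xs) (c ∷ cs , cyc , _ , j , R , eq) with isCycle⇒ c cs cyc
  ... | u , ch =
    chain⇒path x xs R (subst (Cyclic Step) (sym eq) (cyclic-rotate j (c ∷ cs) ch)) ,
    proj₁ (unique-++⁻ (x ∷ xs) (subst Unique (sym eq) (unique-rotate j (c ∷ cs) u)))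

  properBlock⇒block : ∀ P → ProperBlockOf β P → BlockOf β P
  properBlock⇒block P (C , cyc , P≢[] , j , R , _ , eq) = C , cyc , P≢[] , j , R , eq

  block-link : ∀ Q Q′ → IsRun Q → IsRun Q′ → BlockOf β (Q ++ Q′) → Link Q Q′
  block-link (x ∷ xs) (y ∷ ys) _ _ blk = proj₁ (proj₂ (path-++⁻ x xs ys (proj₁ (block⇒run _ blk))))

  properBlock⇒unlinked : ∀ P → ProperBlockOf β P → Unlinked P P
  properBlock⇒unlinked (x ∷ xs) ([] , () , _)
  properBlock⇒unlinked (x ∷ xs) (C , _ , _ , j , [] , R≢[] , _) _ = R≢[] refl
  properBlock⇒unlinked (x ∷ xs) (c ∷ cs , cyc , _ , j , y ∷ ys , _ , eq) link with isCycle⇒ c cs cyc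
  ... | u , ch = All.lookup x∉ (∈-++⁺ʳ xs (here refl)) (trans (sym link) toY)
    where
    x∉ : All (x ≢_) (xs ++ y ∷ ys)
    x∉ with subst Unique (sym eq) (unique-rotate j (c ∷ cs) u)
    ... | x∉ ∷ _ = x∉
    toY : next (last′ x xs) ≡ y
    toY = chain-last x xs (proj₁ (chain-++⁻ x xs ys (subst (Cyclic Step) (sym eq) (cyclic-rotate j (c ∷ cs) ch))))

  -- Conversely, a run P without repeated entries is an initial segment of the cycle through
  -- its first entry, hence a block; it is a proper block unless β closes it up.
  run⇒block : ∀ P → IsRun P → Unique P → BlockOf β P × (Unlinked P P → ProperBlockOf β P)
  run⇒block (x ∷ xs) p (x∉ ∷ _) with orbit x | path⇒orbitList x xs p
  ... | m , cyc , ret | xs≡ with length xs ≤? m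
  ... | no l≰m = ⊥-elim (All.lookup x∉ (subst (x ∈_) (sym xs≡) x∈) refl)
    where
    x∈ : x ∈ orbitList (next x) (length xs)
    x∈ = subst (_∈ orbitList (next x) (length xs)) (trans (iterate-next m x) ret)
                (∈-orbitList⁺ (length xs) (next x) m (≰⇒> l≰m))
  ... | yes l≤m = (_ , cyc , (λ ()) , 0 , rest , segment) ,
                  λ unlinked → _ , cyc , (λ ()) , 0 , rest , rest≢[] unlinked (m ∸ length xs) refl , segment
    where
    rest : List (Fin n)
    rest = orbitList (iterate (suc (length xs)) x) (m ∸ length xs)
    segment : (x ∷ xs) ++ rest ≡ rotate 0 (orbitList x (suc m))
    segment = begin
      (x ∷ xs) ++ rest                                    ≡⟨ cong (λ l → (x ∷ l) ++ rest) xs≡ ⟩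
      orbitList x (suc (length xs)) ++ rest               ≡⟨ orbitList-+ (suc (length xs)) _ x ⟨
      orbitList x (suc (length xs) + (m ∸ length xs))     ≡⟨ cong (λ l → orbitList x (suc l)) (m+[n∸m]≡n l≤m) ⟩
      orbitList x (suc m)                                 ≡⟨ ++-identityʳ _ ⟨
      rotate 0 (orbitList x (suc m))                      ∎
      where open ≡-Reasoning
    rest≢[] : Unlinked (x ∷ xs) (x ∷ xs) → ∀ r → m ∸ length xs ≡ r →
      orbitList (iterate (suc (length xs)) x) r ≢ []
    rest≢[] unlinked zero eq _ = unlinked (begin
      next (last′ x xs)                      ≡⟨ cong (λ l → next (last′ x l)) xs≡ ⟩
      next (last′ x (orbitList (next x) (length xs))) ≡⟨ cong next (last-orbitList (length xs) x) ⟩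
      iterate (suc (length xs)) x            ≡⟨ cong (λ l → iterate (suc l) x) l≡m ⟩
      iterate (suc m) x                      ≡⟨ ret ⟩
      x                                      ∎)
      where
      open ≡-Reasoning
      l≡m : length xs ≡ m
      l≡m = trans (sym (+-identityʳ (length xs))) (trans (cong (length xs +_) (sym eq)) (m+[n∸m]≡n l≤m))
    rest≢[] unlinked (suc r) eq ()

  reach-end : ∀ x xs {e} → Chain Step x xs e → ∀ {y} → y ∈ x ∷ xs → ∃ λ t → iterate t y ≡ e
  reach-end x [] c (here refl) = 1 , c
  reach-end x (z ∷ zs) (r , c) (here refl) with reach-end z zs c (here refl)
  ... | t , q = suc t , trans (sym (iterate-next t x)) (trans (cong (iterate t) r) q)
  reach-end x (z ∷ zs) (r , c) (there m) = reach-end z zs c m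

  reach-from-start : ∀ x xs {e} → Chain Step x xs e → ∀ {y} → y ∈ x ∷ xs → ∃ λ t → iterate t x ≡ y
  reach-from-start x xs c (here refl) = 0 , refl
  reach-from-start x (z ∷ zs) (r , c) (there m) with reach-from-start z zs c m
  ... | t , q = suc t , trans (sym (iterate-next t x)) (trans (cong (iterate t) r) q)

  chain-next : ∀ x xs {e} → Chain Step x xs e → ∀ {y} → y ∈ x ∷ xs → next y ∈ xs ⊎ next y ≡ e
  chain-next x [] c (here refl) = inj₂ c
  chain-next x (z ∷ zs) (r , c) (here refl) = inj₁ (here r)
  chain-next x (z ∷ zs) (r , c) (there m) with chain-next z zs c m
  ... | inj₁ m′ = inj₁ (there m′)
  ... | inj₂ q = inj₂ q

  cycle-closed : ∀ x xs → Cyclic Step (x ∷ xs) → ∀ t {y} → y ∈ x ∷ xs → iterate t y ∈ x ∷ xs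
  cycle-closed x xs c zero m = m
  cycle-closed x xs c (suc t) m with chain-next x xs c (cycle-closed x xs c t m)
  ... | inj₁ m′ = there m′
  ... | inj₂ q = here q

  cycles-disjoint : ∀ C N → IsCycleOf β C → IsCycleOf β N → ∀ {z} → z ∈ N → z ∉ C → Disjoint C N
  cycles-disjoint (c ∷ cs) (m ∷ ms) cycC cycN z∈N z∉C (y∈C , y∈N)
    with isCycle⇒ c cs cycC | isCycle⇒ m ms cycN
  ... | _ , chC | _ , chN with reach-end m ms chN y∈N | reach-from-start m ms chN z∈N
  ... | t , y↦m | t′ , m↦z = z∉C (subst (_∈ c ∷ cs) m↦z
        (subst (λ w → iterate t′ w ∈ c ∷ cs) y↦m (cycle-closed c cs chC t′ (cycle-closed c cs chC t y∈C))))

  record IsRunDecomposition {k} (Q : Fin k → List (Fin n)) : Set where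
    field
      run      : ∀ r → IsRun (Q r)
      unique   : ∀ r → Unique (Q r)
      disjoint : ∀ r s → r ≢ s → Disjoint (Q r) (Q s)
      unlinked : ∀ r → Unlinked (Q r) (Q (cycSuc r))

  record RunDecomposition (L : List (Fin n)) : Set where
    field
      size               : ℕ
      piece              : Fin size → List (Fin n)
      size≥1             : size ≥ 1
      concatenates       : concatF piece ≡ L
      isRunDecomposition : IsRunDecomposition piece

  BlockConditions : ∀ k → (Fin k → List (Fin n)) → Set
  BlockConditions k Q =
      (k ≡ 1 → ∀ r → ProperBlockOf β (Q r))
    × (k > 1 → (∀ r → BlockOf β (Q r))
             × (∀ r s → r ≢ s → Disjoint (Q r) (Q s))
             × (∀ r → ¬ BlockOf β (Q r ++ Q (cycSuc r))))

  runs⇒conditions : ∀ {k} (Q : Fin k → List (Fin n)) → IsRunDecomposition Q → BlockConditions k Q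
  runs⇒conditions Q dec = proper , λ _ → block , disjoint , noJoin
    where
    open IsRunDecomposition dec
    block : ∀ r → BlockOf β (Q r)
    block r = proj₁ (run⇒block (Q r) (run r) (unique r))
    proper : _ ≡ 1 → ∀ r → ProperBlockOf β (Q r)
    proper refl r = proj₂ (run⇒block (Q r) (run r) (unique r))
      (subst (λ s → Unlinked (Q r) (Q s)) (cycSuc-Fin1 r) (unlinked r))
    noJoin : ∀ r → ¬ BlockOf β (Q r ++ Q (cycSuc r))
    noJoin r blk = unlinked r (block-link (Q r) (Q (cycSuc r)) (run r) (run (cycSuc r)) blk)

  conditions⇒runs : ∀ {k} (Q : Fin k → List (Fin n)) → BlockConditions k Q → IsRunDecomposition Q
  conditions⇒runs {zero} Q _ = record { run = λ () ; unique = λ () ; disjoint = λ () ; unlinked = λ () }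
  conditions⇒runs {suc zero} Q (proper , _) = record
    { run      = λ r → proj₁ (block⇒run (Q r) (properBlock⇒block (Q r) (proper refl r)))
    ; unique   = λ r → proj₂ (block⇒run (Q r) (properBlock⇒block (Q r) (proper refl r)))
    ; disjoint = λ { zero zero 0≢0 → ⊥-elim (0≢0 refl) }
    ; unlinked = λ { zero → properBlock⇒unlinked (Q zero) (proper refl zero) }
    }
  conditions⇒runs {suc (suc k)} Q (_ , several) with several (s≤s (s≤s z≤n))
  ... | block , disjoint , noJoin = record
    { run = run ; unique = unique ; disjoint = disjoint ; unlinked = unlinked }
    where
    run : ∀ r → IsRun (Q r)
    run r = proj₁ (block⇒run (Q r) (block r))
    unique : ∀ r → Unique (Q r)
    unique r = proj₂ (block⇒run (Q r) (block r))
    -- a link would make Q r Q (r+1) a run with distinct entries, i.e. a block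
    unlinked : ∀ r → Unlinked (Q r) (Q (cycSuc r))
    unlinked r link = noJoin r (proj₁ (run⇒block (Q r ++ Q (cycSuc r))
      (run-++ (Q r) (Q (cycSuc r)) (run r) (run (cycSuc r)) link)
      (Unique.++⁺ (unique r) (unique (cycSuc r)) (disjoint r (cycSuc r) (λ e → cycSuc-≢ r (sym e))))))

  -- Splitting x xs into maximal runs: x t is the first run, Qs the following ones.
  maximalRuns : Fin n → List (Fin n) → List (Fin n) × List (List (Fin n))
  maximalRuns x [] = [] , []
  maximalRuns x (y ∷ ys) with maximalRuns y ys | next x ≟ y
  ... | t , Qs | yes _ = y ∷ t , Qs
  ... | t , Qs | no _ = [] , (y ∷ t) ∷ Qs

  maximalRuns-spec : ∀ x xs → let (t , Qs) = maximalRuns x xs in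
    ((x ∷ t) ++ concat Qs ≡ x ∷ xs) × Path x t × All IsRun Qs ×
    (∀ e es → next (last′ x xs) ≢ e → Chain Unlinked (x ∷ t) Qs (e ∷ es))
  maximalRuns-spec x [] = refl , tt , [] , λ e es ne → ne
  maximalRuns-spec x (y ∷ ys) with maximalRuns y ys | maximalRuns-spec y ys | next x ≟ y
  ... | t , Qs | concat≡ , path , runs , unlinked | yes step =
    cong (x ∷_) concat≡ , (step , path) , runs , λ e es ne → extendHead Qs (unlinked e es ne)
    where
    -- prepending x to the first run does not change its last entry
    extendHead : ∀ Qs {E} → Chain Unlinked (y ∷ t) Qs E → Chain Unlinked (x ∷ y ∷ t) Qs E
    extendHead [] {[]} c = λ ()
    extendHead [] {_ ∷ _} c = c
    extendHead ([] ∷ _) (_ , c) = (λ ()) , c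
    extendHead ((_ ∷ _) ∷ _) (u , c) = u , c
  ... | t , Qs | concat≡ , path , runs , unlinked | no ¬step =
    cong (x ∷_) concat≡ , tt , (path ∷ runs) , λ e es ne → ¬step , unlinked e es ne

module Commutator {n : ℕ} (α β : Permutation′ n) where
  open Orbits β

  α⟨_⟩ : Fin n → Fin n
  α⟨ x ⟩ = α ⟨$⟩ʳ x

  α-injective : ∀ {u v} → α⟨ u ⟩ ≡ α⟨ v ⟩ → u ≡ v
  α-injective e = trans (sym (inverseˡ α)) (trans (cong (α ⟨$⟩ˡ_) e) (inverseˡ α))

  γ : Fin n → Fin n
  γ x = α⟨ next (α ⟨$⟩ˡ x) ⟩

  γ-conjugate : ∀ u → γ α⟨ u ⟩ ≡ α⟨ next u ⟩
  γ-conjugate u = cong (λ z → α⟨ next z ⟩) (inverseˡ α)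

  StepΓ : Fin n → Fin n → Set
  StepΓ u v = γ u ≡ v

  chain-conjugate : ∀ x xs e → Chain Step x xs e → Chain StepΓ α⟨ x ⟩ (map α⟨_⟩ xs) α⟨ e ⟩
  chain-conjugate x [] e c = trans (γ-conjugate x) (cong α⟨_⟩ c)
  chain-conjugate x (y ∷ ys) e (r , c) = trans (γ-conjugate x) (cong α⟨_⟩ r) , chain-conjugate y ys e c

  last-map : ∀ x xs → last′ α⟨ x ⟩ (map α⟨_⟩ xs) ≡ α⟨ last′ x xs ⟩
  last-map x [] = refl
  last-map x (y ∷ ys) = last-map y ys

  Differs : Fin n → Set
  Differs u = (α · β) ⟨$⟩ʳ u ≢ (β · α) ⟨$⟩ʳ u

  differs? : Decidable Differs
  differs? u = ¬? ((α · β) ⟨$⟩ʳ u ≟ (β · α) ⟨$⟩ʳ u)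

  Break : Fin n → Set
  Break y = next y ≢ γ y

  break? : Decidable Break
  break? y = ¬? (next y ≟ γ y)

  -- Since αβ(u) = γ(α u) and βα(u) = β(α u), αβ and βα differ at u iff α u is a break.
  count-differs : ∀ L → count differs? L ≡ count break? (map α⟨_⟩ L)
  count-differs L = sym (count-map break? differs? α⟨_⟩ correspond L)
    where
    correspond : ∀ u → (Differs u → Break α⟨ u ⟩) × (Break α⟨ u ⟩ → Differs u)
    correspond u = (λ d e → d (sym (trans e (γ-conjugate u)))) , λ b e → b (trans (sym e) (sym (γ-conjugate u)))

  run-breaks : ∀ x xs {e} → Path x xs → Chain StepΓ x xs e → next (last′ x xs) ≢ e →
    count break? (x ∷ xs) ≡ 1
  run-breaks x [] _ γx≡e ne = cong length (filter-accept break? (λ βx≡γx → ne (trans βx≡γx γx≡e)))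
  run-breaks x (y ∷ ys) (βx≡y , p) (γx≡y , c) ne =
    trans (cong length (filter-reject break? (λ brk → brk (trans βx≡y (sym γx≡y))))) (run-breaks y ys p c ne)

  runs-breaks : ∀ x xs Qs e es → All IsRun ((x ∷ xs) ∷ Qs) → Chain Unlinked (x ∷ xs) Qs (e ∷ es) →
    Chain StepΓ x (xs ++ concat Qs) e → count break? (x ∷ xs ++ concat Qs) ≡ suc (length Qs)
  runs-breaks x xs [] e es (p ∷ []) unl c =
    subst (λ l → count break? (x ∷ l) ≡ 1) (sym (++-identityʳ xs))
      (run-breaks x xs p (subst (λ l → Chain StepΓ x l e) (++-identityʳ xs) c) unl)
  runs-breaks x xs ([] ∷ Qs) e es (_ ∷ () ∷ _) _ _
  runs-breaks x xs ((y ∷ ys) ∷ Qs) e es (p ∷ ps) (unl , unls) c with chain-++⁻ x xs (ys ++ concat Qs) c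
  ... | c₁ , c₂ = begin
    count break? ((x ∷ xs) ++ y ∷ ys ++ concat Qs)              ≡⟨ count-++ break? (x ∷ xs) _ ⟩
    count break? (x ∷ xs) + count break? (y ∷ ys ++ concat Qs)  ≡⟨ cong₂ _+_ (run-breaks x xs p c₁ unl)
                                                                        (runs-breaks y ys Qs e es ps unls c₂) ⟩
    suc (suc (length Qs))                                       ∎
    where open ≡-Reasoning

  decomposition-breaks : ∀ k (Q : Fin (suc k) → List (Fin n)) → IsRunDecomposition Q →
    Cyclic StepΓ (concatF Q) → count break? (concatF Q) ≡ suc k
  decomposition-breaks k Q dec = breaks (Q zero) (run zero) (cyclic-tabulate⁺ k Q unlinked)
    where
    open IsRunDecomposition dec
    Rest : List (List (Fin n))
    Rest = tabulate (λ i → Q (suc i))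
    breaks : ∀ Q₀ → IsRun Q₀ → Chain Unlinked Q₀ Rest Q₀ → Cyclic StepΓ (Q₀ ++ concat Rest) →
      count break? (Q₀ ++ concat Rest) ≡ suc k
    breaks (x ∷ xs) p unl c = trans (runs-breaks x xs Rest x xs (p ∷ AllP.tabulate⁺ (λ i → run (suc i))) unl c)
                                    (cong suc (length-tabulate (λ i → Q (suc i))))

  cycle-breaks : ∀ C → IsCycleOf β C → ∀ k (Q : Fin k → List (Fin n)) → k ≥ 1 →
    IsRotationOf (concatF Q) (map α⟨_⟩ C) → IsRunDecomposition Q → count break? (map α⟨_⟩ C) ≡ k
  cycle-breaks (c ∷ cs) cyc zero Q () _ _
  cycle-breaks (c ∷ cs) cyc (suc k) Q _ (j , rot≡) dec = begin
    count break? (map α⟨_⟩ (c ∷ cs))             ≡⟨ count-rotate break? j _ ⟨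
    count break? (rotate j (map α⟨_⟩ (c ∷ cs)))  ≡⟨ cong (count break?) rot≡ ⟩
    count break? (concatF Q)                     ≡⟨ decomposition-breaks k Q dec cyclic ⟩
    suc k                                        ∎
    where
    open ≡-Reasoning
    cyclic : Cyclic StepΓ (concatF Q)
    cyclic = subst (Cyclic StepΓ) rot≡ (cyclic-rotate j _ (chain-conjugate c cs c (proj₂ (isCycle⇒ c cs cyc))))

  -- If αβ ≠ βα at the last entry of the cycle notation c cs, then β does not lead from the
  -- end of α(c cs) back to α c, so the maximal runs of α(c cs) form a run decomposition.
  decompose : ∀ c cs → IsCycleOf β (c ∷ cs) → Differs (last′ c cs) → RunDecomposition (map α⟨_⟩ (c ∷ cs))
  decompose c cs cyc differs with isCycle⇒ c cs cyc | maximalRuns-spec α⟨ c ⟩ (map α⟨_⟩ cs)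
  ... | u , ch | concat≡ , path , runs , unlinked = record
    { size = suc (length Qs) ; piece = Q ; size≥1 = s≤s z≤n ; concatenates = concatQ
    ; isRunDecomposition = record
      { run      = λ r → All.lookup (path ∷ runs) (∈-lookup r)
      ; unique   = proj₁ distinct
      ; disjoint = proj₂ distinct
      ; unlinked = cyclic-tabulate⁻ (length Qs) Q
          (subst (λ Rs → Chain Unlinked (Q zero) Rs (Q zero)) (sym (tabulate-lookup Qs)) (unlinked α⟨ c ⟩ t noWrap))
      }
    }
    where
    t : List (Fin n)
    t = proj₁ (maximalRuns α⟨ c ⟩ (map α⟨_⟩ cs))
    Qs : List (List (Fin n))
    Qs = proj₂ (maximalRuns α⟨ c ⟩ (map α⟨_⟩ cs))
    Q : Fin (suc (length Qs)) → List (Fin n)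
    Q = lookup ((α⟨ c ⟩ ∷ t) ∷ Qs)
    concatQ : concatF Q ≡ map α⟨_⟩ (c ∷ cs)
    concatQ = trans (cong concat (tabulate-lookup ((α⟨ c ⟩ ∷ t) ∷ Qs))) concat≡
    distinct : (∀ r → Unique (Q r)) × (∀ r s → r ≢ s → Disjoint (Q r) (Q s))
    distinct = unique-concatF⁻ Q (subst Unique (sym concatQ) (Unique.map⁺ α-injective u))
    noWrap : next (last′ α⟨ c ⟩ (map α⟨_⟩ cs)) ≢ α⟨ c ⟩
    noWrap wrap = differs (begin
      α⟨ next (last′ c cs) ⟩               ≡⟨ cong α⟨_⟩ (chain-last c cs ch) ⟩
      α⟨ c ⟩                               ≡⟨ wrap ⟨
      next (last′ α⟨ c ⟩ (map α⟨_⟩ cs))    ≡⟨ cong next (last-map c cs) ⟩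
      next α⟨ last′ c cs ⟩                 ∎)
      where open ≡-Reasoning

  H-as-breaks : ∀ {h} (C : Fin h → List (Fin n)) → (∀ i → Unique (C i)) →
    (∀ i j → i ≢ j → Disjoint (C i) (C j)) → (∀ x → Differs x → ∃ λ i → x ∈ C i) →
    H (α · β) (β · α) ≡ Σ[ (λ i → count break? (map α⟨_⟩ (C i))) ]
  H-as-breaks C unique disjoint covered = begin
    count differs? (allFin n)                 ≡⟨ ≤-antisym allFin≤C C≤allFin ⟩
    count differs? (concatF C)                ≡⟨ count-concatF differs? C ⟩
    Σ[ (λ i → count differs? (C i)) ]         ≡⟨ cong sum (tabulate-cong (λ i → count-differs (C i))) ⟩
    Σ[ (λ i → count break? (map α⟨_⟩ (C i))) ] ∎
    where
    open ≡-Reasoning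
    allFin≤C : count differs? (allFin n) ≤ count differs? (concatF C)
    allFin≤C = count-≤ differs? (allFin n) (concatF C) (Unique.allFin⁺ n)
      (λ x d _ → let (i , m) = covered x d in ∈-concatF⁺ C i m)
    C≤allFin : count differs? (concatF C) ≤ count differs? (allFin n)
    C≤allFin = count-≤ differs? (concatF C) (allFin n) (unique-concatF⁺ C unique disjoint) (λ x _ _ → ∈-allFin x)

  entries : Fin n × List (Fin n) → List (Fin n)
  entries N = proj₁ N ∷ proj₂ N

  lastEntry : Fin n × List (Fin n) → Fin n
  lastEntry N = last′ (proj₁ N) (proj₂ N)

  record Selection : Set where
    field
      h            : ℕ
      cycles       : Fin h → Fin n × List (Fin n)
      isCycle      : ∀ i → IsCycleOf β (entries (cycles i))
      disjoint     : ∀ i j → i ≢ j → Disjoint (entries (cycles i)) (entries (cycles j))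
      differsAtEnd : ∀ i → Differs (lastEntry (cycles i))

    notation : Fin h → List (Fin n)
    notation i = entries (cycles i)

  open Selection using (notation)

  Covers : Selection → Fin n → Set
  Covers s x = ∃ λ i → x ∈ notation s i

  cycleEndingAt : ∀ x → Σ (Fin n × List (Fin n)) λ N →
    IsCycleOf β (entries N) × lastEntry N ≡ x
  cycleEndingAt x with orbit (next x)
  ... | m , cyc , ret = (next x , orbitList (next (next x)) m) , cyc ,
    next-injective (trans (cong next (last-orbitList m (next x))) ret)

  -- Adding the cycle through an uncovered point x with αβ(x) ≠ βα(x) keeps the cycles
  -- disjoint, since that cycle contains x while the others do not.
  add-cycle : (s : Selection) → ∀ x → ¬ Covers s x → Differs x →
    Σ Selection λ s′ → (∀ y → Covers s y → Covers s′ y) × Covers s′ x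
  add-cycle s x uncovered differs with cycleEndingAt x
  ... | N , cycN , endN = record
    { h = suc h ; cycles = cycles′ ; isCycle = isCycle′ ; disjoint = disjoint′ ; differsAtEnd = differsAtEnd′ } ,
    (λ { y (i , m) → suc i , m }) , (zero , x∈N)
    where
    open Selection s hiding (notation)
    x∈N : x ∈ entries N
    x∈N = subst (_∈ entries N) endN (last′∈ (proj₁ N) (proj₂ N))
    cycles′ : Fin (suc h) → Fin n × List (Fin n)
    cycles′ zero = N
    cycles′ (suc i) = cycles i
    isCycle′ : ∀ i → IsCycleOf β (entries (cycles′ i))
    isCycle′ zero = cycN
    isCycle′ (suc i) = isCycle i
    differsAtEnd′ : ∀ i → Differs (lastEntry (cycles′ i))
    differsAtEnd′ zero = subst Differs (sym endN) differs
    differsAtEnd′ (suc i) = differsAtEnd i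
    apart : ∀ i → Disjoint (notation s i) (entries N)
    apart i = cycles-disjoint (notation s i) _ (isCycle i) cycN x∈N (λ m → uncovered (i , m))
    disjoint′ : ∀ i j → i ≢ j → Disjoint (entries (cycles′ i)) (entries (cycles′ j))
    disjoint′ zero zero 0≢0 = ⊥-elim (0≢0 refl)
    disjoint′ zero (suc j) _ (m₁ , m₂) = apart j (m₂ , m₁)
    disjoint′ (suc i) zero _ = apart i
    disjoint′ (suc i) (suc j) ne = disjoint i j (λ e → ne (cong suc e))

  cover-point : (s : Selection) → ∀ x →
    Σ Selection λ s′ → (∀ y → Covers s y → Covers s′ y) × (Differs x → Covers s′ x)
  cover-point s x with differs? x
  ... | no same = s , (λ y c → c) , λ d → ⊥-elim (same d)
  ... | yes d with any? (λ i → member? _≟_ x (notation s i))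
  ... | yes covered = s , (λ y c → c) , λ _ → covered
  ... | no uncovered with add-cycle s x uncovered d
  ... | s′ , keeps , covers = s′ , keeps , λ _ → covers

  cover : Σ Selection λ s → ∀ x → Differs x → Covers s x
  cover = let (s , covers) = cover-list (allFin n) in s , λ x → covers x (∈-allFin x)
    where
    cover-list : (xs : List (Fin n)) → Σ Selection λ s → ∀ y → y ∈ xs → Differs y → Covers s y
    cover-list [] = record { h = 0 ; cycles = λ () ; isCycle = λ () ; disjoint = λ () ; differsAtEnd = λ () } , λ _ ()
    cover-list (x ∷ xs) with cover-list xs
    ... | s , covers with cover-point s x
    ... | s′ , keeps , coversX = s′ , λ { y (here refl) d → coversX d ; y (there m) d → keeps y (covers y m d) }

  -- Pieces of the decompositions of αC₁, …, αC_h for disjoint C₁, …, C_h are pairwise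
  -- disjoint, since α is injective.
  pieces-disjoint : ∀ {h} (C : Fin h → List (Fin n)) → (∀ i j → i ≢ j → Disjoint (C i) (C j)) →
    (ks : Fin h → ℕ) (P : (i : Fin h) → Fin (ks i) → List (Fin n)) →
    (∀ i → concatF (P i) ≡ map α⟨_⟩ (C i)) → (∀ i r s → r ≢ s → Disjoint (P i r) (P i s)) →
    ∀ (x y : Σ (Fin h) (λ i → Fin (ks i))) → x ≢ y → Disjoint (P (proj₁ x) (proj₂ x)) (P (proj₁ y) (proj₂ y))
  pieces-disjoint C disjoint ks P concat≡ within (i , r) (j , t) x≢y with i ≟ j
  ... | yes refl = within i r t (λ r≡t → x≢y (cong (i ,_) r≡t))
  ... | no i≢j = λ (z∈Pᵢ , z∈Pⱼ) → apart (preimage i r z∈Pᵢ) (preimage j t z∈Pⱼ)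
    where
    preimage : ∀ i r {z} → z ∈ P i r → ∃ λ u → u ∈ C i × z ≡ α⟨ u ⟩
    preimage i r {z} m = ∈-map⁻ α⟨_⟩ (subst (z ∈_) (concat≡ i) (∈-concatF⁺ (P i) r m))
    apart : ∀ {z} → (∃ λ u → u ∈ C i × z ≡ α⟨ u ⟩) → (∃ λ u → u ∈ C j × z ≡ α⟨ u ⟩) → ⊥
    apart (u , u∈ , z≡) (u′ , u′∈ , z≡′) =
      disjoint i j i≢j (u∈ , subst (_∈ C j) (α-injective (trans (sym z≡′) z≡)) u′∈)

  Characterisation : ℕ → Set
  Characterisation k =
    ∃ λ h → ∃ λ (C : Fin h → List (Fin n)) → ∃ λ (ks : Fin h → ℕ) →
      ∃ λ (P : (i : Fin h) → Fin (ks i) → List (Fin n)) →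
        (∀ i → IsCycleOf β (C i))
      × (∀ i j → i ≢ j → Disjoint (C i) (C j))
      × (∀ b → (∀ i → b ∉ C i) → (α · β) ⟨$⟩ʳ b ≡ (β · α) ⟨$⟩ʳ b)
      × (∀ i → ks i ≥ 1)
      × (∀ i → IsRotationOf (concatF (P i)) (map (α ⟨$⟩ʳ_) (C i)))
      × (k ≡ Σ[ ks ])
      × (∀ i → ks i ≡ 1 → ∀ r → ProperBlockOf β (P i r))
      × (∀ i → ks i > 1 →
            (∀ r → BlockOf β (P i r))
          × (∀ r s → r ≢ s → Disjoint (P i r) (P i s))
          × (∀ r → ¬ BlockOf β (P i r ++ P i (cycSuc r))))
      × (∀ (x : Σ (Fin h) (λ i → Fin (ks i))) → BlockOf β (P (proj₁ x) (proj₂ x)))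
      × (∀ (x y : Σ (Fin h) (λ i → Fin (ks i))) → x ≢ y →
            Disjoint (P (proj₁ x) (proj₂ x)) (P (proj₁ y) (proj₂ y)))

  -- Take the cycles covering all points where αβ ≠ βα and split their α-images into
  -- maximal runs; the runs are the required blocks and their number is H(αβ, βα).
  forward : ∀ k → H (α · β) (β · α) ≡ k → Characterisation k
  forward k H≡k = h , C , size , piece , isCycle , disjoint , commute , size≥1 , rotation , k≡Σ ,
    (λ i → proj₁ (conditions i)) , (λ i → proj₂ (conditions i)) , (λ (i , r) → block i r) ,
    pieces-disjoint C disjoint size piece concatenates (λ i → IsRunDecomposition.disjoint (isRunDecomposition i))
    where
    s : Selection
    s = proj₁ cover
    open Selection s hiding (notation)
    C : Fin h → List (Fin n)
    C = notation s
    decomposition : ∀ i → RunDecomposition (map α⟨_⟩ (C i))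
    decomposition i = decompose _ _ (isCycle i) (differsAtEnd i)
    module Decomposition (i : Fin h) = RunDecomposition (decomposition i)
    open Decomposition
    commute : ∀ x → (∀ i → x ∉ C i) → (α · β) ⟨$⟩ʳ x ≡ (β · α) ⟨$⟩ʳ x
    commute x outside = decidable-stable (_ ≟ _) (λ d → let (i , m) = proj₂ cover x d in outside i m)
    rotation : ∀ i → IsRotationOf (concatF (piece i)) (map α⟨_⟩ (C i))
    rotation i = 0 , trans (++-identityʳ _) (sym (concatenates i))
    k≡Σ : k ≡ Σ[ size ]
    k≡Σ = trans (sym H≡k) (trans (H-as-breaks C (λ i → cycle-unique (C i) (isCycle i)) disjoint (proj₂ cover))
      (cong sum (tabulate-cong (λ i →
        cycle-breaks (C i) (isCycle i) (size i) (piece i) (size≥1 i) (rotation i) (isRunDecomposition i)))))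
    conditions : ∀ i → BlockConditions (size i) (piece i)
    conditions i = runs⇒conditions (piece i) (isRunDecomposition i)
    block : ∀ i r → BlockOf β (piece i r)
    block i r = let open IsRunDecomposition (isRunDecomposition i) in proj₁ (run⇒block (piece i r) (run r) (unique r))

  -- Conversely, the given cycles cover all points where αβ ≠ βα, and by (1)–(2) the given
  -- blocks are a run decomposition of each αCᵢ, so H(αβ, βα) = Σ kᵢ.
  backward : ∀ k → Characterisation k → H (α · β) (β · α) ≡ k
  backward k (h , C , ks , P , isCycle , disjoint , commute , ks≥1 , rotation , k≡Σ , one , several , _ , _) = begin
    H (α · β) (β · α)                          ≡⟨ H-as-breaks C (λ i → cycle-unique (C i) (isCycle i)) disjoint covered ⟩
    Σ[ (λ i → count break? (map α⟨_⟩ (C i))) ] ≡⟨ cong sum (tabulate-cong breaks) ⟩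
    Σ[ ks ]                                    ≡⟨ k≡Σ ⟨
    k                                          ∎
    where
    open ≡-Reasoning
    covered : ∀ x → Differs x → ∃ λ i → x ∈ C i
    covered x d with any? (λ i → member? _≟_ x (C i))
    ... | yes inside = inside
    ... | no outside = ⊥-elim (d (commute x (λ i m → outside (i , m))))
    breaks : ∀ i → count break? (map α⟨_⟩ (C i)) ≡ ks i
    breaks i = cycle-breaks (C i) (isCycle i) (ks i) (P i) (ks≥1 i) (rotation i)
      (conditions⇒runs (P i) (one i , several i))

corollary2 : ∀ {n} (α β : Permutation′ n) (k : ℕ) →
    (H (α · β) (β · α) ≡ k) ⇔
    (∃ λ h → ∃ λ (C : Fin h → List (Fin n)) → ∃ λ (ks : Fin h → ℕ) →
      ∃ λ (P : (i : Fin h) → Fin (ks i) → List (Fin n)) →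
        (∀ i → IsCycleOf β (C i))
      × (∀ i j → i ≢ j → Disjoint (C i) (C j))
      × (∀ b → (∀ i → b ∉ C i) → (α · β) ⟨$⟩ʳ b ≡ (β · α) ⟨$⟩ʳ b)
      × (∀ i → ks i ≥ 1)
      × (∀ i → IsRotationOf (concatF (P i)) (map (α ⟨$⟩ʳ_) (C i)))
      × (k ≡ Σ[ ks ])
      × (∀ i → ks i ≡ 1 → ∀ r → ProperBlockOf β (P i r))
      × (∀ i → ks i > 1 →
            (∀ r → BlockOf β (P i r))
          × (∀ r s → r ≢ s → Disjoint (P i r) (P i s))
          × (∀ r → ¬ BlockOf β (P i r ++ P i (cycSuc r))))
      × (∀ (x : Σ (Fin h) (λ i → Fin (ks i))) → BlockOf β (P (proj₁ x) (proj₂ x)))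
      × (∀ (x y : Σ (Fin h) (λ i → Fin (ks i))) → x ≢ y →
            Disjoint (P (proj₁ x) (proj₂ x)) (P (proj₁ y) (proj₂ y))))
corollary2 α β k = mk⇔ (Commutator.forward α β k) (Commutator.backward α β k)
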